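{- Let $(K_n,\Sigma)$ be a signed complete graph and let $\mathcal{C}$ be a set of $n$-vertex signed graphs (on vertex set $V(K_n)$) such that: (i) $(K_n,\Sigma')\in\mathcal{C}$ if and only if $\Sigma'=\Sigma$; (ii) for each $(G,\Sigma')\in\mathcal{C}$ with $G\neq K_n$ there is an edge $vw\in E(K_n)\setminus E(G)$ such that $(G+vw,\Sigma')$ or $(G+vw,\Sigma'\cup\{vw\})$ is in $\mathcal{C}$; (iii) for each $(G,\Sigma')\in\mathcal{C}$ and $vw\in E(G)$, $(G\setminus vw,\Sigma'\setminus\{vw\})\in\mathcal{C}$ if and only if spectral integral variation occurs under the addition of $vw$ to $(G\setminus vw,\Sigma'\setminus\{vw\})$ with the same parity as in $(K_n,\Sigma)$. Then a signed graph is integrally $\Sigma$-completable if and only if it belongs to $\mathcal{C}$.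
   Context: A signed graph is a pair $(G,\Sigma)$ with $\Sigma\subseteq E(G)$ (odd edges; others even). $A(G,\Sigma)$ has entry $1$ for even edges, $-1$ for odd edges, $0$ otherwise; $L(G,\Sigma)=D(G)-A(G,\Sigma)$. Adding an even (resp. odd) edge $vw$ to $(G,\Gamma)$ gives $(G+vw,\Gamma)$ (resp. $(G+vw,\Gamma\cup\{vw\})$); "with the same parity as in $(K_n,\Sigma)$" means the added edge is odd iff $vw\in\Sigma$. Spectral integral variation occurs if the spectra of the signed Laplacians before and after the addition differ by integer quantities. An $n$-vertex signed graph $(G,\Sigma')$ is integrally $\Sigma$-completable if there are signed graphs $(G_0,\Sigma_0)=(G,\Sigma'),\dots,(G_m,\Sigma_m)=(K_n,\Sigma)$ such that for each $i\in[m]$, $(G_i,\Sigma_i)$ is obtained from $(G_{i-1},\Sigma_{i-1})$ by adding a new (odd or even) edge $v_iw_i\in E(K_n)\setminus E(G_{i-1})$ with spectral integral variation. -}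

module Defs where

open import Data.Nat using (ℕ)
open import Data.Integer using (ℤ; +_; -_; _-_; 0ℤ)
open import Data.Fin using (Fin; _≟_)
open import Data.Vec using (Vec; lookup; tabulate; map; sum; _[_]≔_)
open import Data.Bool using (if_then_else_)
open import Data.Product using (_×_; Σ; ∃; _,_)
open import Data.Sum using (_⊎_)
open import Relation.Nullary using (¬_)
open import Relation.Nullary.Decidable using (⌊_⌋)
open import Relation.Binary.PropositionalEquality using (_≡_; _≢_)
open import Function.Bundles using (_⇔_)

-- Status of an unordered vertex pair in a signed graph:
-- not an edge, an even edge, or an odd edge (member of Σ).
data Sign : Set where
  none even odd : Sign

-- A signed graph on vertex set Fin n, given by its (symmetric) table of
-- pair statuses.  Two signed graphs are equal iff their tables are equal.
Graph : ℕ → Set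
Graph n = Vec (Vec Sign n) n

module _ {n : ℕ} where

  entry : Graph n → Fin n → Fin n → Sign
  entry g i j = lookup (lookup g i) j

  WF : Graph n → Set
  WF g = (∀ i → entry g i i ≡ none) × (∀ i j → entry g i j ≡ entry g j i)

  Complete : Graph n → Set
  Complete g = ∀ i j → i ≢ j → entry g i j ≢ none

  setPair : Graph n → Fin n → Fin n → Sign → Graph n
  setPair g v w s = h [ w ]≔ (lookup h w [ v ]≔ s)
    where h = g [ v ]≔ (lookup g v [ w ]≔ s)

  addEdge : Graph n → Fin n → Fin n → Sign → Graph n
  addEdge = setPair

  delEdge : Graph n → Fin n → Fin n → Graph n
  delEdge g v w = setPair g v w none

  adj : Sign → ℤ
  adj none = 0ℤ
  adj even = + 1
  adj odd  = - (+ 1)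

  isEdge : Sign → ℕ
  isEdge none = 0
  isEdge even = 1
  isEdge odd  = 1

  degree : Graph n → Fin n → ℕ
  degree g i = sum (map isEdge (lookup g i))

  laplacian : Graph n → Vec (Vec ℤ n) n
  laplacian g = tabulate λ i → tabulate λ j →
    (if ⌊ i ≟ j ⌋ then + degree g i else 0ℤ) - adj (entry g i j)

  -- Spectral integral variation from g to h, relative to a relation R on
  -- integer matrices expressing "the spectra differ by integer quantities".
  SIV : (Vec (Vec ℤ n) n → Vec (Vec ℤ n) n → Set) → Graph n → Graph n → Set
  SIV R g h = R (laplacian g) (laplacian h)

  data Completable (R : Vec (Vec ℤ n) n → Vec (Vec ℤ n) n → Set) (K : Graph n)
       : Graph n → Set where
    done : Completable R K K
    step : ∀ g v w s → v ≢ w → entry g v w ≡ none → s ≢ none →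
           SIV R g (addEdge g v w s) →
           Completable R K (addEdge g v w s) → Completable R K g

-- Both directions rest on one observation: if (G, Σ') misses the pair vw and
-- (H, Σ'') is obtained by adding vw with the parity it has in (K_n, Σ), then
-- (iii) applied to H says (G, Σ') ∈ 𝒞 iff the addition G → H has spectral
-- integral variation, provided H ∈ 𝒞.  Edges are never removed along a
-- completion, so every edge added there carries its parity in (K_n, Σ).
-- Hence a completion of G is walked backwards from K_n ∈ 𝒞 through 𝒞, and
-- conversely (ii) produces a completion of any G ∈ 𝒞, by induction on the
-- number of missing pairs.
module Submission where

open import Defs
open import Data.Nat using (ℕ; zero; suc; _+_; _≤_; _<_; z≤n; s≤s)
open import Data.Nat.Properties using (≤-refl; +-mono-≤; +-mono-<-≤; +-mono-≤-<)
open import Data.Nat.Induction using (<-wellFounded)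
open import Data.Integer using (ℤ)
open import Data.Fin using (Fin; zero; suc; _≟_)
open import Data.Fin.Properties using (all?)
open import Data.Vec using (Vec; lookup; tabulate; _[_]≔_)
open import Data.Vec.Properties using (lookup∘update; lookup∘update′; tabulate∘lookup; tabulate-cong)
open import Data.Product using (_×_; ∃; ∃₂; _,_)
open import Data.Sum using (_⊎_; inj₁; inj₂; [_,_])
open import Data.Empty using (⊥-elim)
open import Function using (_∘_)
open import Function.Bundles using (_⇔_; mk⇔; Equivalence)
open import Induction.WellFounded using (Acc; acc)
open import Relation.Nullary using (¬_; Dec; yes; no)
open import Relation.Nullary.Decidable using (¬?; _→-dec_)
open import Relation.Binary.PropositionalEquality
  using (_≡_; _≢_; refl; sym; trans; subst; subst₂; module ≡-Reasoning)
open ≡-Reasoning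

_≟ˢ_ : (a b : Sign) → Dec (a ≡ b)
none ≟ˢ none = yes refl
none ≟ˢ even = no λ ()
none ≟ˢ odd  = no λ ()
even ≟ˢ none = no λ ()
even ≟ˢ even = yes refl
even ≟ˢ odd  = no λ ()
odd  ≟ˢ none = no λ ()
odd  ≟ˢ even = no λ ()
odd  ≟ˢ odd  = yes refl

lookup-ext : ∀ {A : Set} {m} (xs ys : Vec A m) →
             (∀ i → lookup xs i ≡ lookup ys i) → xs ≡ ys
lookup-ext xs ys eq = begin
  xs                   ≡⟨ sym (tabulate∘lookup xs) ⟩
  tabulate (lookup xs) ≡⟨ tabulate-cong eq ⟩
  tabulate (lookup ys) ≡⟨ tabulate∘lookup ys ⟩
  ys                   ∎

∑ : ∀ {m} → (Fin m → ℕ) → ℕ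
∑ {zero}  f = 0
∑ {suc m} f = f zero + ∑ (f ∘ suc)

∑-mono-≤ : ∀ {m} {f g : Fin m → ℕ} → (∀ i → f i ≤ g i) → ∑ f ≤ ∑ g
∑-mono-≤ {zero}  f≤g = z≤n
∑-mono-≤ {suc m} f≤g = +-mono-≤ (f≤g zero) (∑-mono-≤ (f≤g ∘ suc))

∑-mono-< : ∀ {m} {f g : Fin m → ℕ} → (∀ i → f i ≤ g i) → ∀ k → f k < g k → ∑ f < ∑ g
∑-mono-< {suc m} f≤g zero    f<g = +-mono-<-≤ f<g (∑-mono-≤ (f≤g ∘ suc))
∑-mono-< {suc m} f≤g (suc k) f<g = +-mono-≤-< (f≤g zero) (∑-mono-< (f≤g ∘ suc) k f<g)

module _ {n : ℕ} where

  graph-ext : (g h : Graph n) → (∀ i j → entry g i j ≡ entry h i j) → g ≡ h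
  graph-ext g h eq = lookup-ext g h λ i → lookup-ext (lookup g i) (lookup h i) (eq i)

  Complete? : (g : Graph n) → Dec (Complete g)
  Complete? g = all? λ i → all? λ j → ¬? (i ≟ j) →-dec ¬? (entry g i j ≟ˢ none)

  setEntry : Graph n → Fin n → Fin n → Sign → Graph n
  setEntry g v w s = g [ v ]≔ (lookup g v [ w ]≔ s)

  entry-setEntry-≡ : ∀ g v w s → entry (setEntry g v w s) v w ≡ s
  entry-setEntry-≡ g v w s rewrite lookup∘update v g (lookup g v [ w ]≔ s) =
    lookup∘update w (lookup g v) s

  entry-setEntry-≢ : ∀ g {v w} s {i j} → i ≢ v ⊎ j ≢ w →
                     entry (setEntry g v w s) i j ≡ entry g i j
  entry-setEntry-≢ g {v} {w} s {i} {j} i≢v⊎j≢w with i ≟ v | i≢v⊎j≢w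
  ... | no i≢v   | _ rewrite lookup∘update′ i≢v g (lookup g v [ w ]≔ s) = refl
  ... | yes refl | inj₁ i≢i = ⊥-elim (i≢i refl)
  ... | yes refl | inj₂ j≢w rewrite lookup∘update i g (lookup g i [ w ]≔ s) =
    lookup∘update′ j≢w (lookup g i) s

  entry-setPair-wv : ∀ g v w s → entry (setPair g v w s) w v ≡ s
  entry-setPair-wv g v w s = entry-setEntry-≡ (setEntry g v w s) w v s

  entry-setPair-vw : ∀ g v w s → entry (setPair g v w s) v w ≡ s
  entry-setPair-vw g v w s with v ≟ w
  ... | yes refl = entry-setPair-wv g v v s
  ... | no v≢w   = trans (entry-setEntry-≢ (setEntry g v w s) s (inj₁ v≢w))
                         (entry-setEntry-≡ g v w s)

  entry-setPair-≢ : ∀ g {v w} s {i j} → i ≢ v ⊎ j ≢ w → i ≢ w ⊎ j ≢ v →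
                    entry (setPair g v w s) i j ≡ entry g i j
  entry-setPair-≢ g {v} {w} s ≢vw ≢wv =
    trans (entry-setEntry-≢ (setEntry g v w s) s ≢wv) (entry-setEntry-≢ g s ≢vw)

  data PairView (v w i j : Fin n) : Set where
    at-vw     : i ≡ v → j ≡ w → PairView v w i j
    at-wv     : i ≡ w → j ≡ v → PairView v w i j
    elsewhere : i ≢ v ⊎ j ≢ w → i ≢ w ⊎ j ≢ v → PairView v w i j

  pairView : ∀ v w i j → PairView v w i j
  pairView v w i j with i ≟ v | j ≟ w | i ≟ w | j ≟ v
  ... | yes p | yes q | _     | _     = at-vw p q
  ... | _     | _     | yes p | yes q = at-wv p q
  ... | no p  | _     | no q  | _     = elsewhere (inj₁ p) (inj₁ q)
  ... | no p  | _     | yes _ | no q  = elsewhere (inj₁ p) (inj₂ q)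
  ... | yes _ | no p  | no q  | _     = elsewhere (inj₂ p) (inj₁ q)
  ... | yes _ | no p  | yes _ | no q  = elsewhere (inj₂ p) (inj₂ q)

  setPair-WF : ∀ g {v w} s → v ≢ w → WF g → WF (setPair g v w s)
  setPair-WF g {v} {w} s v≢w (loopless , symmetric) = loopless′ , symmetric′
    where
    loopless′ : ∀ i → entry (setPair g v w s) i i ≡ none
    loopless′ i with pairView v w i i
    ... | at-vw refl refl = ⊥-elim (v≢w refl)
    ... | at-wv refl refl = ⊥-elim (v≢w refl)
    ... | elsewhere p q   = trans (entry-setPair-≢ g s p q) (loopless i)

    symmetric′ : ∀ i j → entry (setPair g v w s) i j ≡ entry (setPair g v w s) j i
    symmetric′ i j with pairView v w i j | pairView v w j i
    ... | at-vw refl refl | _ = trans (entry-setPair-vw g v w s) (sym (entry-setPair-wv g v w s))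
    ... | at-wv refl refl | _ = trans (entry-setPair-wv g v w s) (sym (entry-setPair-vw g v w s))
    ... | elsewhere p _ | at-wv refl refl = ⊥-elim ([ (λ f → f refl) , (λ f → f refl) ] p)
    ... | elsewhere _ q | at-vw refl refl = ⊥-elim ([ (λ f → f refl) , (λ f → f refl) ] q)
    ... | elsewhere p q | elsewhere p′ q′ = begin
      entry (setPair g v w s) i j ≡⟨ entry-setPair-≢ g s p q ⟩
      entry g i j                 ≡⟨ symmetric i j ⟩
      entry g j i                 ≡⟨ sym (entry-setPair-≢ g s p′ q′) ⟩
      entry (setPair g v w s) j i ∎

  setPair-entry-≢none : ∀ g {v w} s {i j} → WF g → entry g v w ≡ none →
                        entry g i j ≢ none → entry (setPair g v w s) i j ≡ entry g i j
  setPair-entry-≢none g {v} {w} s {i} {j} (_ , symmetric) vw-none ij-edge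
    with pairView v w i j
  ... | at-vw refl refl = ⊥-elim (ij-edge vw-none)
  ... | at-wv refl refl = ⊥-elim (ij-edge (trans (symmetric w v) vw-none))
  ... | elsewhere p q   = entry-setPair-≢ g s p q

  delEdge-addEdge : ∀ g {v w} s → WF g → entry g v w ≡ none →
                    delEdge (addEdge g v w s) v w ≡ g
  delEdge-addEdge g {v} {w} s (_ , symmetric) vw-none = graph-ext _ g same
    where
    h : Graph n
    h = addEdge g v w s
    same : ∀ i j → entry (delEdge (addEdge g v w s) v w) i j ≡ entry g i j
    same i j with pairView v w i j
    ... | at-vw refl refl = trans (entry-setPair-vw h v w none) (sym vw-none)
    ... | at-wv refl refl = trans (entry-setPair-wv h v w none) (sym (trans (symmetric w v) vw-none))
    ... | elsewhere p q   = trans (entry-setPair-≢ h none p q) (entry-setPair-≢ g s p q)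

  isMissing : Sign → ℕ
  isMissing none = 1
  isMissing even = 0
  isMissing odd  = 0

  missing : Graph n → ℕ
  missing g = ∑ λ i → ∑ λ j → isMissing (entry g i j)

  missing-addEdge : ∀ g {v w} s → s ≢ none → entry g v w ≡ none →
                    missing (addEdge g v w s) < missing g
  missing-addEdge g {v} {w} s s-edge vw-none =
    ∑-mono-< (λ i → ∑-mono-≤ (pointwise i)) v (∑-mono-< (pointwise v) w at-vw′)
    where
    isMissing-edge : ∀ {t} → t ≡ s → isMissing t ≡ 0
    isMissing-edge {none} refl = ⊥-elim (s-edge refl)
    isMissing-edge {even} _ = refl
    isMissing-edge {odd}  _ = refl

    pointwise : ∀ i j → isMissing (entry (addEdge g v w s) i j) ≤ isMissing (entry g i j)
    pointwise i j with pairView v w i j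
    ... | at-vw refl refl rewrite isMissing-edge (entry-setPair-vw g v w s) = z≤n
    ... | at-wv refl refl rewrite isMissing-edge (entry-setPair-wv g v w s) = z≤n
    ... | elsewhere p q rewrite entry-setPair-≢ g s p q = ≤-refl

    at-vw′ : isMissing (entry (addEdge g v w s) v w) < isMissing (entry g v w)
    at-vw′ rewrite isMissing-edge (entry-setPair-vw g v w s) | vw-none = s≤s z≤n

  completable-entry : ∀ {R K g} i j → Completable R K g → WF g →
                      entry g i j ≢ none → entry K i j ≡ entry g i j
  completable-entry i j done _ _ = refl
  completable-entry {g = g} i j (step _ v w s v≢w vw-none _ _ rest) wf ij-edge =
    trans (completable-entry i j rest (setPair-WF g s v≢w wf) (ij-edge ∘ trans (sym kept)))
          kept
    where
    kept : entry (addEdge g v w s) i j ≡ entry g i j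
    kept = setPair-entry-≢none g s wf vw-none ij-edge

  completable-added-entry : ∀ {R K} g {v w s} → s ≢ none →
                            Completable R K (addEdge g v w s) → WF (addEdge g v w s) →
                            entry K v w ≡ s
  completable-added-entry g {v} {w} {s} s-edge c wf =
    trans (completable-entry v w c wf (s-edge ∘ trans (sym vw-s))) vw-s
    where
    vw-s : entry (addEdge g v w s) v w ≡ s
    vw-s = entry-setPair-vw g v w s

module Characterisation
    {n : ℕ} (R : Vec (Vec ℤ n) n → Vec (Vec ℤ n) n → Set)
    (K : Graph n) (K-WF : WF K) (K-complete : Complete K)
    (C : Graph n → Set)
    (C-WF : ∀ g → C g → WF g)
    (C-complete : ∀ g → WF g → Complete g → (C g ⇔ (g ≡ K)))
    (C-extend : ∀ g → C g → ¬ Complete g →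
      ∃₂ λ v w → v ≢ w × entry g v w ≡ none ×
        (C (addEdge g v w even) ⊎ C (addEdge g v w odd)))
    (C-delete : ∀ g v w → C g → v ≢ w → entry g v w ≢ none →
      (C (delEdge g v w) ⇔
        SIV R (delEdge g v w) (addEdge (delEdge g v w) v w (entry K v w))))
  where

  C-addEdge⇔SIV : ∀ g {v w s} → WF g → v ≢ w → entry g v w ≡ none → s ≢ none →
                   C (addEdge g v w s) → entry K v w ≡ s →
                   C g ⇔ SIV R g (addEdge g v w s)
  C-addEdge⇔SIV g {v} {w} {s} wf v≢w vw-none s-edge C-h K-vw =
    subst₂ (λ g′ t → C g′ ⇔ SIV R g′ (addEdge g′ v w t))
           (delEdge-addEdge g s wf vw-none) K-vw
           (C-delete (addEdge g v w s) v w C-h v≢w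
                     (s-edge ∘ trans (sym (entry-setPair-vw g v w s))))

  completable⇒C : ∀ g → WF g → Completable R K g → C g
  completable⇒C g _  done = Equivalence.from (C-complete K K-WF K-complete) refl
  completable⇒C g wf (step _ v w s v≢w vw-none s-edge siv rest) =
    Equivalence.from (C-addEdge⇔SIV g wf v≢w vw-none s-edge C-h
                        (completable-added-entry g s-edge rest wf-h))
                     siv
    where
    wf-h : WF (addEdge g v w s)
    wf-h = setPair-WF g s v≢w wf
    C-h : C (addEdge g v w s)
    C-h = completable⇒C _ wf-h rest

  C-extend′ : ∀ g → C g → ¬ Complete g →
              ∃₂ λ v w → v ≢ w × entry g v w ≡ none ×
                ∃ λ s → s ≢ none × C (addEdge g v w s)
  C-extend′ g C-g incomplete with C-extend g C-g incomplete
  ... | v , w , v≢w , vw-none , inj₁ C-h = v , w , v≢w , vw-none , even , (λ ()) , C-h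
  ... | v , w , v≢w , vw-none , inj₂ C-h = v , w , v≢w , vw-none , odd  , (λ ()) , C-h

  C⇒completable : ∀ g → Acc _<_ (missing g) → C g → Completable R K g
  C⇒completable g (acc smaller) C-g with Complete? g
  ... | yes complete =
    subst (Completable R K) (sym (Equivalence.to (C-complete g (C-WF g C-g) complete) C-g)) done
  ... | no incomplete with C-extend′ g C-g incomplete
  ... | v , w , v≢w , vw-none , s , s-edge , C-h =
    step g v w s v≢w vw-none s-edge siv rest
    where
    rest : Completable R K (addEdge g v w s)
    rest = C⇒completable _ (smaller (missing-addEdge g s s-edge vw-none)) C-h
    K-vw : entry K v w ≡ s
    K-vw = completable-added-entry g s-edge rest (C-WF _ C-h)
    siv : SIV R g (addEdge g v w s)
    siv = Equivalence.to (C-addEdge⇔SIV g (C-WF g C-g) v≢w vw-none s-edge C-h K-vw) C-g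

lemma3p9 : (n : ℕ) (R : Vec (Vec ℤ n) n → Vec (Vec ℤ n) n → Set)
    (K : Graph n) → WF K → Complete K →
    (C : Graph n → Set) →
    (∀ g → C g → WF g) →
    (∀ g → WF g → Complete g → (C g ⇔ (g ≡ K))) →
    (∀ g → C g → ¬ Complete g →
      ∃₂ λ v w → v ≢ w × entry g v w ≡ none ×
        (C (addEdge g v w even) ⊎ C (addEdge g v w odd))) →
    (∀ g v w → C g → v ≢ w → entry g v w ≢ none →
      (C (delEdge g v w) ⇔
        SIV R (delEdge g v w) (addEdge (delEdge g v w) v w (entry K v w)))) →
    ∀ g → WF g → (Completable R K g ⇔ C g)
lemma3p9 n R K K-WF K-complete C C-WF C-complete C-extend C-delete g wf =
  mk⇔ (completable⇒C g wf) (C⇒completable g (<-wellFounded (missing g)))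
  where open Characterisation R K K-WF K-complete C C-WF C-complete C-extend C-delete
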